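{- Let $p$ be the partially ordered pattern of length 4 whose occurrences in a permutation $\pi=\pi_1\cdots\pi_n$ are the subsequences $\pi_{i_1}\pi_{i_2}\pi_{i_3}\pi_{i_4}$ with $i_1<i_2<i_3<i_4$ such that $\pi_{i_1}<\pi_{i_2}$, $\pi_{i_3}<\pi_{i_2}$ and $\pi_{i_3}<\pi_{i_4}$. Let $a(n)$ be the number of permutations of $[n]$ avoiding $p$. Then $a(0)=a(1)=1$ and $a(n)=4a(n-1)-3a(n-2)+1$ for $n\geq 2$; consequently $a(n)=\frac{3^n-2n+3}{4}$ for all $n\ge 0$ and $$\sum_{n\geq 0}a(n)x^n=\frac{(1-2x)^2}{(1-3x)(1-x)^2}.$$
   Context: A permutation avoids a pattern if it contains no occurrence of it; the empty permutation counts for $n=0$. -}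

module Defs where

open import Data.Nat using (ℕ; zero; suc; _∸_)
open import Data.Integer using (ℤ) renaming (_+_ to _+ℤ_; _*_ to _*ℤ_; +_ to ⁺_)
open import Data.Fin using (Fin; _<_; _≟_)
open import Data.Fin.Properties using (any?; all?; _<?_)
open import Data.Vec using (Vec; []; _∷_; lookup)
open import Data.List using (List; []; _∷_; map; concatMap; allFin; filter; length; upTo; foldr)
open import Data.Product using (Σ; ∃; _×_; _,_)
open import Relation.Nullary using (Dec; ¬_; ¬?)
open import Relation.Nullary.Decidable using (_×-dec_; _→-dec_)
open import Relation.Binary.PropositionalEquality using (_≡_)

-- A permutation of [n] in one-line notation: a word π₁⋯πₙ over Fin n
-- (values 0..n-1 stand for 1..n) with pairwise distinct letters.
IsPerm : ∀ {n} → Vec (Fin n) n → Set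
IsPerm {n} π = ∀ (i j : Fin n) → lookup π i ≡ lookup π j → i ≡ j

Occurs : ∀ {n} → Vec (Fin n) n → Set
Occurs {n} π =
  Σ (Fin n) λ i₁ → Σ (Fin n) λ i₂ → Σ (Fin n) λ i₃ → Σ (Fin n) λ i₄ →
    (i₁ < i₂) × (i₂ < i₃) × (i₃ < i₄) ×
    (lookup π i₁ < lookup π i₂) × (lookup π i₃ < lookup π i₂) × (lookup π i₃ < lookup π i₄)

Avoids : ∀ {n} → Vec (Fin n) n → Set
Avoids π = ¬ Occurs π

isPerm? : ∀ {n} (π : Vec (Fin n) n) → Dec (IsPerm π)
isPerm? π = all? λ i → all? λ j → (lookup π i ≟ lookup π j) →-dec (i ≟ j)

occurs? : ∀ {n} (π : Vec (Fin n) n) → Dec (Occurs π)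
occurs? π = any? λ i₁ → any? λ i₂ → any? λ i₃ → any? λ i₄ →
  (i₁ <? i₂) ×-dec (i₂ <? i₃) ×-dec (i₃ <? i₄) ×-dec
  (lookup π i₁ <? lookup π i₂) ×-dec (lookup π i₃ <? lookup π i₂) ×-dec (lookup π i₃ <? lookup π i₄)

words : ∀ n k → List (Vec (Fin n) k)
words n zero = [] ∷ []
words n (suc k) = concatMap (λ x → map (x ∷_) (words n k)) (allFin n)

a : ℕ → ℕ
a n = length (filter (λ π → isPerm? π ×-dec ¬? (occurs? π)) (words n n))

-- formal power series over ℤ as coefficient sequences, with Cauchy product
Series : Set
Series = ℕ → ℤ

_⊛_ : Series → Series → Series
(f ⊛ g) n = foldr _+ℤ_ (⁺ 0) (map (λ k → f k *ℤ g (n ∸ k)) (upTo (suc n)))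

-- polynomial from its coefficient list (constant term first)
poly : List ℤ → Series
poly [] n = ⁺ 0
poly (c ∷ cs) zero = c
poly (c ∷ cs) (suc n) = poly cs n

A : Series
A n = ⁺ (a n)

-- Removing the maximum from a permutation π of [n+1] leaves a permutation σ of [n] and the slot s where the
-- maximum stood. In an occurrence of p the maximum can only play the role of π(i₂) or π(i₄), so π avoids p
-- iff σ avoids p and s is not obstructed: no ascent of σ starts at or after s (when s > 0), and no peak
-- σ(i) < σ(j) > σ(k) lies before s. If σ avoids p and J is the last position at which an ascent of σ starts,
-- then σ decreases after J and the unobstructed slots are exactly 0, J+1 and J+2; for the decreasing
-- permutation, the only one without an ascent, all n+1 slots are free. Hence a(n+1) = 3(a(n) - 1) + n + 1, and the second-order recurrence,
-- the closed form and the generating function follow by integer algebra.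

module Submission where

module Counting where

  open import Data.Nat using (ℕ; zero; suc; _+_; _*_; _<_)
  open import Data.Nat.Properties using (+-assoc; *-zeroʳ; *-identityʳ; *-distribˡ-+; +-commutativeSemigroup)
  open import Algebra.Properties.CommutativeSemigroup +-commutativeSemigroup using (interchange)
  open import Data.Fin using (Fin; zero; suc; toℕ; fromℕ<)
  open import Data.Fin.Properties using (toℕ-injective; toℕ-fromℕ<; suc-injective) renaming (_≟_ to _≟ᶠ_)
  open import Data.List using (List; []; _∷_; _++_; map; concat; concatMap; filter; length; allFin)
  open import Data.List.Properties using (map-tabulate)
  open import Data.Product using (Σ; _×_; _,_; proj₁; proj₂)
  open import Relation.Nullary using (Dec; yes; no; ¬_)
  open import Relation.Nullary.Decidable using (_×-dec_)
  open import Relation.Unary using (Pred; Decidable)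
  open import Relation.Binary.Definitions using (DecidableEquality)
  open import Relation.Binary.PropositionalEquality
  open import Data.Empty using (⊥-elim)
  open import Function using (id)

  ⟦_⟧ : ∀ {p} {P : Set p} → Dec P → ℕ
  ⟦ yes _ ⟧ = 1
  ⟦ no _ ⟧ = 0

  module _ {p} {P : Set p} where

    ⟦⟧-yes : (d : Dec P) → P → ⟦ d ⟧ ≡ 1
    ⟦⟧-yes (yes _) _ = refl
    ⟦⟧-yes (no ¬p) p = ⊥-elim (¬p p)

    ⟦⟧-no : (d : Dec P) → ¬ P → ⟦ d ⟧ ≡ 0
    ⟦⟧-no (yes p) ¬p = ⊥-elim (¬p p)
    ⟦⟧-no (no _) _ = refl

  module _ {p q} {P : Set p} {Q : Set q} where

    ⟦⟧-⇔ : (d : Dec P) (e : Dec Q) → (P → Q) → (Q → P) → ⟦ d ⟧ ≡ ⟦ e ⟧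
    ⟦⟧-⇔ (yes p) e to _ = sym (⟦⟧-yes e (to p))
    ⟦⟧-⇔ (no ¬p) e _ from = sym (⟦⟧-no e (λ q → ¬p (from q)))

    ⟦⟧-× : (d : Dec P) (e : Dec Q) → ⟦ d ×-dec e ⟧ ≡ ⟦ d ⟧ * ⟦ e ⟧
    ⟦⟧-× (yes p) (yes q) = refl
    ⟦⟧-× (yes p) (no ¬q) = refl
    ⟦⟧-× (no ¬p) e = refl

  ∑ : ∀ {a} {A : Set a} → List A → (A → ℕ) → ℕ
  ∑ [] f = 0
  ∑ (x ∷ xs) f = f x + ∑ xs f

  syntax ∑ xs (λ x → e) = ∑[ x ∈ xs ] e

  module _ {a} {A : Set a} where

    ∑-cong : (xs : List A) {f g : A → ℕ} → (∀ x → f x ≡ g x) → ∑ xs f ≡ ∑ xs g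
    ∑-cong [] e = refl
    ∑-cong (x ∷ xs) e = cong₂ _+_ (e x) (∑-cong xs e)

    ∑-+ : (xs : List A) (f g : A → ℕ) → ∑[ x ∈ xs ] (f x + g x) ≡ ∑ xs f + ∑ xs g
    ∑-+ [] f g = refl
    ∑-+ (x ∷ xs) f g = trans (cong (f x + g x +_) (∑-+ xs f g)) (interchange (f x) (g x) _ _)

    ∑-*ˡ : (xs : List A) (c : ℕ) (f : A → ℕ) → ∑[ x ∈ xs ] (c * f x) ≡ c * ∑ xs f
    ∑-*ˡ [] c f = sym (*-zeroʳ c)
    ∑-*ˡ (x ∷ xs) c f = trans (cong (c * f x +_) (∑-*ˡ xs c f)) (sym (*-distribˡ-+ c (f x) _))

    ∑-zero : (xs : List A) (f : A → ℕ) → (∀ x → f x ≡ 0) → ∑ xs f ≡ 0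
    ∑-zero [] f e = refl
    ∑-zero (x ∷ xs) f e = cong₂ _+_ (e x) (∑-zero xs f e)

    ∑-++ : (xs ys : List A) (f : A → ℕ) → ∑ (xs ++ ys) f ≡ ∑ xs f + ∑ ys f
    ∑-++ [] ys f = refl
    ∑-++ (x ∷ xs) ys f = trans (cong (f x +_) (∑-++ xs ys f)) (sym (+-assoc (f x) _ _))

    ∑-1≡length : (xs : List A) → ∑[ _ ∈ xs ] 1 ≡ length xs
    ∑-1≡length [] = refl
    ∑-1≡length (x ∷ xs) = cong suc (∑-1≡length xs)

    length-filter≡∑ : ∀ {p} {P : Pred A p} (P? : Decidable P) (xs : List A) →
                      length (filter P? xs) ≡ ∑[ x ∈ xs ] ⟦ P? x ⟧
    length-filter≡∑ P? [] = refl
    length-filter≡∑ P? (x ∷ xs) with P? x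
    ... | yes _ = cong suc (length-filter≡∑ P? xs)
    ... | no _ = length-filter≡∑ P? xs

  module _ {a b} {A : Set a} {B : Set b} where

    ∑-map : (h : A → B) (xs : List A) (f : B → ℕ) → ∑ (map h xs) f ≡ ∑[ x ∈ xs ] f (h x)
    ∑-map h [] f = refl
    ∑-map h (x ∷ xs) f = cong (f (h x) +_) (∑-map h xs f)

    ∑-concatMap : (h : A → List B) (xs : List A) (f : B → ℕ) →
                  ∑ (concatMap h xs) f ≡ ∑[ x ∈ xs ] ∑ (h x) f
    ∑-concatMap h [] f = refl
    ∑-concatMap h (x ∷ xs) f =
      trans (∑-++ (h x) (concat (map h xs)) f) (cong (∑ (h x) f +_) (∑-concatMap h xs f))

    ∑-comm : (xs : List A) (ys : List B) (f : A → B → ℕ) →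
             ∑[ x ∈ xs ] ∑[ y ∈ ys ] f x y ≡ ∑[ y ∈ ys ] ∑[ x ∈ xs ] f x y
    ∑-comm [] ys f = sym (∑-zero ys _ (λ _ → refl))
    ∑-comm (x ∷ xs) ys f = trans (cong (∑ ys (f x) +_) (∑-comm xs ys f)) (sym (∑-+ ys (f x) _))

  ∑-allFin-suc : ∀ n (f : Fin (suc n) → ℕ) → ∑ (allFin (suc n)) f ≡ f zero + ∑[ i ∈ allFin n ] f (suc i)
  ∑-allFin-suc n f = cong (f zero +_) (trans (cong (λ is → ∑ is f) (sym (map-tabulate id suc))) (∑-map suc (allFin n) f))

  IsEnumeration : ∀ {a} {A : Set a} → DecidableEquality A → List A → Set a
  IsEnumeration _≟_ xs = ∀ z → ∑[ x ∈ xs ] ⟦ x ≟ z ⟧ ≡ 1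

  allFin-isEnumeration : ∀ n → IsEnumeration _≟ᶠ_ (allFin n)
  allFin-isEnumeration (suc n) zero =
    trans (∑-allFin-suc n (λ i → ⟦ i ≟ᶠ zero ⟧)) (cong suc (∑-zero (allFin n) _ (λ i → ⟦⟧-no (suc i ≟ᶠ zero) (λ ()))))
  allFin-isEnumeration (suc n) (suc z) =
    trans (∑-allFin-suc n (λ i → ⟦ i ≟ᶠ suc z ⟧))
          (trans (∑-cong (allFin n) (λ i → ⟦⟧-⇔ (suc i ≟ᶠ suc z) (i ≟ᶠ z) suc-injective (cong suc)))
                 (allFin-isEnumeration n z))

  ∑-allFin-toℕ≡ : ∀ m c → c < m → ∑[ i ∈ allFin m ] ⟦ toℕ i Data.Nat.≟ c ⟧ ≡ 1
  ∑-allFin-toℕ≡ m c c<m =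
    trans (∑-cong (allFin m) (λ i → ⟦⟧-⇔ (toℕ i Data.Nat.≟ c) (i ≟ᶠ fromℕ< c<m)
                                  (λ e → toℕ-injective (trans e (sym (toℕ-fromℕ< c<m))))
                                  (λ { refl → toℕ-fromℕ< c<m })))
          (allFin-isEnumeration m (fromℕ< c<m))

  module _ {a b c} {A : Set a} {B : Set b} {C : Set c}
           (_≟A_ : DecidableEquality A) (_≟B_ : DecidableEquality B) (_≟C_ : DecidableEquality C)
           (pair : A → B → C)
           (pair-surjective : ∀ z → Σ A λ x → Σ B λ y → z ≡ pair x y)
           (pair-injective : ∀ {x y x′ y′} → pair x y ≡ pair x′ y′ → x ≡ x′ × y ≡ y′) where

    private
      ⟦pair≟pair⟧ : ∀ x y x′ y′ → ⟦ pair x y ≟C pair x′ y′ ⟧ ≡ ⟦ x ≟A x′ ⟧ * ⟦ y ≟B y′ ⟧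
      ⟦pair≟pair⟧ x y x′ y′ with x ≟A x′ | y ≟B y′
      ... | yes refl | yes refl = ⟦⟧-yes (pair x y ≟C pair x y) refl
      ... | yes _ | no y≢y′ = ⟦⟧-no (pair x y ≟C pair x′ y′) (λ e → y≢y′ (proj₂ (pair-injective e)))
      ... | no x≢x′ | _ = ⟦⟧-no (pair x y ≟C pair x′ y′) (λ e → x≢x′ (proj₁ (pair-injective e)))

    pairs-isEnumeration : (xs : List A) (ys : List B) → IsEnumeration _≟A_ xs → IsEnumeration _≟B_ ys →
                          IsEnumeration _≟C_ (concatMap (λ x → map (pair x) ys) xs)
    pairs-isEnumeration xs ys enum-xs enum-ys z with pair-surjective z
    ... | x′ , y′ , refl = begin
      ∑ (concatMap (λ x → map (pair x) ys) xs) (λ w → ⟦ w ≟C pair x′ y′ ⟧)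
        ≡⟨ ∑-concatMap _ xs _ ⟩
      ∑[ x ∈ xs ] ∑ (map (pair x) ys) (λ w → ⟦ w ≟C pair x′ y′ ⟧)
        ≡⟨ ∑-cong xs (λ x → trans (∑-map (pair x) ys _) (∑-cong ys (λ y → ⟦pair≟pair⟧ x y x′ y′))) ⟩
      ∑[ x ∈ xs ] ∑[ y ∈ ys ] (⟦ x ≟A x′ ⟧ * ⟦ y ≟B y′ ⟧)
        ≡⟨ ∑-cong xs (λ x → trans (∑-*ˡ ys ⟦ x ≟A x′ ⟧ _) (cong (⟦ x ≟A x′ ⟧ *_) (enum-ys y′))) ⟩
      ∑[ x ∈ xs ] (⟦ x ≟A x′ ⟧ * 1)
        ≡⟨ ∑-cong xs (λ x → *-identityʳ ⟦ x ≟A x′ ⟧) ⟩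
      ∑[ x ∈ xs ] ⟦ x ≟A x′ ⟧
        ≡⟨ enum-xs x′ ⟩
      1 ∎
      where open ≡-Reasoning

  -- Double counting of the pairs (x , y) with Q y and x ≡ g y.
  module _ {a b p q} {A : Set a} {B : Set b}
           (_≟A_ : DecidableEquality A) (_≟B_ : DecidableEquality B)
           {P : Pred A p} {Q : Pred B q} (P? : Decidable P) (Q? : Decidable Q)
           (f : A → B) (g : B → A)
           (f-sound : ∀ x → P x → Q (f x) × g (f x) ≡ x)
           (g-sound : ∀ y → Q y → P (g y) × f (g y) ≡ y) where

    private
      fibre-of-P : ∀ x y → P x → ⟦ Q? y ⟧ * ⟦ x ≟A g y ⟧ ≡ ⟦ y ≟B f x ⟧
      fibre-of-P x y px with Q? y | x ≟A g y
      ... | yes qy | yes refl = sym (⟦⟧-yes (y ≟B f (g y)) (sym (proj₂ (g-sound y qy))))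
      ... | yes qy | no x≢gy = sym (⟦⟧-no (y ≟B f x) (λ e → x≢gy (trans (sym (proj₂ (f-sound x px))) (cong g (sym e)))))
      ... | no ¬qy | _ = sym (⟦⟧-no (y ≟B f x) (λ e → ¬qy (subst Q (sym e) (proj₁ (f-sound x px)))))

      fibre-of-¬P : ∀ x y → ¬ P x → ⟦ Q? y ⟧ * ⟦ x ≟A g y ⟧ ≡ 0
      fibre-of-¬P x y ¬px with Q? y | x ≟A g y
      ... | yes qy | yes refl = ⊥-elim (¬px (proj₁ (g-sound y qy)))
      ... | yes _ | no _ = refl
      ... | no _ | _ = refl

      ⟦P⟧≡fibre : (ys : List B) → IsEnumeration _≟B_ ys →
                  ∀ x → ⟦ P? x ⟧ ≡ ∑[ y ∈ ys ] (⟦ Q? y ⟧ * ⟦ x ≟A g y ⟧)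
      ⟦P⟧≡fibre ys enum-ys x with P? x
      ... | yes px = sym (trans (∑-cong ys (λ y → fibre-of-P x y px)) (enum-ys (f x)))
      ... | no ¬px = sym (∑-zero ys _ (λ y → fibre-of-¬P x y ¬px))

    ∑⟦⟧-bijection : (xs : List A) (ys : List B) → IsEnumeration _≟A_ xs → IsEnumeration _≟B_ ys →
                    ∑[ x ∈ xs ] ⟦ P? x ⟧ ≡ ∑[ y ∈ ys ] ⟦ Q? y ⟧
    ∑⟦⟧-bijection xs ys enum-xs enum-ys = begin
      ∑[ x ∈ xs ] ⟦ P? x ⟧
        ≡⟨ ∑-cong xs (⟦P⟧≡fibre ys enum-ys) ⟩
      ∑[ x ∈ xs ] ∑[ y ∈ ys ] (⟦ Q? y ⟧ * ⟦ x ≟A g y ⟧)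
        ≡⟨ ∑-comm xs ys _ ⟩
      ∑[ y ∈ ys ] ∑[ x ∈ xs ] (⟦ Q? y ⟧ * ⟦ x ≟A g y ⟧)
        ≡⟨ ∑-cong ys (λ y → trans (∑-*ˡ xs ⟦ Q? y ⟧ _) (trans (cong (⟦ Q? y ⟧ *_) (enum-xs (g y))) (*-identityʳ _))) ⟩
      ∑[ y ∈ ys ] ⟦ Q? y ⟧ ∎
      where open ≡-Reasoning

module MaximumInsertion where

  open import Defs
  open import Data.Nat as ℕ using (ℕ; zero; suc; z≤n; s≤s)
  import Data.Nat.Properties as ℕ
  open import Data.Fin using (Fin; zero; suc; toℕ; fromℕ; inject₁; punchIn; punchOut; _<_; _≟_; fromℕ<)
  open import Data.Fin.Properties
    using (toℕ<n; toℕ-fromℕ; toℕ-fromℕ<; toℕ-inject₁; toℕ-injective; ≤fromℕ; fromℕ≢inject₁; inject₁-injective;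
           punchIn-injective; punchInᵢ≢i; punchIn-punchOut; punchOut-punchIn; punchOut-injective; pigeonhole;
           any?; _<?_)
  open import Data.Vec using (Vec; []; _∷_; lookup; insertAt; removeAt; map)
  open import Data.Vec.Properties
    using (insertAt-lookup; insertAt-punchIn; lookup-map; removeAt-insertAt; insertAt-removeAt; removeAt-punchOut;
           map-∘; map-cong; map-id)
  open import Data.Product using (Σ; _×_; _,_; proj₂; uncurry)
  open import Data.Sum using (_⊎_; inj₁; inj₂)
  open import Relation.Nullary using (Dec; yes; no; ¬_)
  open import Relation.Nullary.Decidable using (_×-dec_; _⊎-dec_)
  open import Relation.Binary.PropositionalEquality
  open import Data.Empty using (⊥-elim)
  open import Function using (_∘_)

  toℕ-punchIn-< : ∀ {n} (s : Fin (suc n)) (j : Fin n) → toℕ j ℕ.< toℕ s → toℕ (punchIn s j) ≡ toℕ j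
  toℕ-punchIn-< (suc s) zero _ = refl
  toℕ-punchIn-< (suc s) (suc j) (s≤s j<s) = cong suc (toℕ-punchIn-< s j j<s)

  toℕ-punchIn-≥ : ∀ {n} (s : Fin (suc n)) (j : Fin n) → toℕ s ℕ.≤ toℕ j → toℕ (punchIn s j) ≡ suc (toℕ j)
  toℕ-punchIn-≥ zero j _ = refl
  toℕ-punchIn-≥ (suc s) (suc j) (s≤s s≤j) = cong suc (toℕ-punchIn-≥ s j s≤j)

  punchIn-mono-< : ∀ {n} (s : Fin (suc n)) (j k : Fin n) → j < k → punchIn s j < punchIn s k
  punchIn-mono-< zero j k j<k = s≤s j<k
  punchIn-mono-< (suc s) zero (suc k) _ = s≤s z≤n
  punchIn-mono-< (suc s) (suc j) (suc k) (s≤s j<k) = s≤s (punchIn-mono-< s j k j<k)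

  punchIn-cancel-< : ∀ {n} (s : Fin (suc n)) (j k : Fin n) → punchIn s j < punchIn s k → j < k
  punchIn-cancel-< zero j k (s≤s j<k) = j<k
  punchIn-cancel-< (suc s) zero (suc k) _ = s≤s z≤n
  punchIn-cancel-< (suc s) (suc j) (suc k) (s≤s j<k) = s≤s (punchIn-cancel-< s j k j<k)

  punchIn<s⇒j<s : ∀ {n} (s : Fin (suc n)) (j : Fin n) → punchIn s j < s → toℕ j ℕ.< toℕ s
  punchIn<s⇒j<s s j p<s with toℕ j ℕ.<? toℕ s
  ... | yes j<s = j<s
  ... | no j≮s = ⊥-elim (ℕ.<-asym p<s (subst (toℕ s ℕ.<_) (sym (toℕ-punchIn-≥ s j (ℕ.≮⇒≥ j≮s))) (s≤s (ℕ.≮⇒≥ j≮s))))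

  s<punchIn⇒s≤j : ∀ {n} (s : Fin (suc n)) (j : Fin n) → s < punchIn s j → toℕ s ℕ.≤ toℕ j
  s<punchIn⇒s≤j s j s<p with toℕ j ℕ.<? toℕ s
  ... | yes j<s = ⊥-elim (ℕ.<-asym s<p (subst (ℕ._< toℕ s) (sym (toℕ-punchIn-< s j j<s)) j<s))
  ... | no j≮s = ℕ.≮⇒≥ j≮s

  data PunchInView {n} (s : Fin (suc n)) : Fin (suc n) → Set where
    hole : PunchInView s s
    punched : (j : Fin n) → PunchInView s (punchIn s j)

  punchInView : ∀ {n} (s p : Fin (suc n)) → PunchInView s p
  punchInView s p with s ≟ p
  ... | yes refl = hole
  ... | no s≢p = subst (PunchInView s) (punchIn-punchOut s≢p) (punched (punchOut s≢p))

  fromℕ≮ : ∀ {n} (x : Fin (suc n)) → ¬ fromℕ n < x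
  fromℕ≮ x n<x = ℕ.<⇒≱ n<x (≤fromℕ x)

  inject₁<fromℕ : ∀ {n} (x : Fin n) → inject₁ x < fromℕ n
  inject₁<fromℕ {n} x = subst₂ ℕ._<_ (sym (toℕ-inject₁ x)) (sym (toℕ-fromℕ n)) (toℕ<n x)

  inject₁-cancel-< : ∀ {n} {x y : Fin n} → inject₁ x < inject₁ y → x < y
  inject₁-cancel-< {x = x} {y} = subst₂ ℕ._<_ (toℕ-inject₁ x) (toℕ-inject₁ y)

  inject₁-mono-< : ∀ {n} {x y : Fin n} → x < y → inject₁ x < inject₁ y
  inject₁-mono-< {x = x} {y} = subst₂ ℕ._<_ (sym (toℕ-inject₁ x)) (sym (toℕ-inject₁ y))

  -- Left inverse of inject₁; the junk value zero is taken only at fromℕ.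
  clamp : ∀ {m} → Fin (suc (suc m)) → Fin (suc m)
  clamp {m} x with toℕ x ℕ.<? suc m
  ... | yes x<m = fromℕ< x<m
  ... | no _ = zero

  clamp-inject₁ : ∀ {m} (x : Fin (suc m)) → clamp (inject₁ x) ≡ x
  clamp-inject₁ {m} x with toℕ (inject₁ x) ℕ.<? suc m
  ... | yes x<m = toℕ-injective (trans (toℕ-fromℕ< x<m) (toℕ-inject₁ x))
  ... | no x≮m = ⊥-elim (x≮m (subst (ℕ._< suc m) (sym (toℕ-inject₁ x)) (toℕ<n x)))

  inject₁-clamp : ∀ {m} (x : Fin (suc (suc m))) → x ≢ fromℕ (suc m) → inject₁ (clamp x) ≡ x
  inject₁-clamp {m} x x≢max with toℕ x ℕ.<? suc m
  ... | yes x<m = toℕ-injective (trans (toℕ-inject₁ _) (toℕ-fromℕ< x<m))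
  ... | no x≮m = ⊥-elim (x≢max (toℕ-injective (trans (ℕ.≤-antisym (ℕ.≤-pred (toℕ<n x)) (ℕ.≮⇒≥ x≮m))
                                                        (sym (toℕ-fromℕ (suc m))))))

  lowerAll : ∀ {n} → Vec (Fin (suc n)) n → Vec (Fin n) n
  lowerAll {zero} [] = []
  lowerAll {suc m} xs = map clamp xs

  lowerAll-inject₁ : ∀ {n} (σ : Vec (Fin n) n) → lowerAll (map inject₁ σ) ≡ σ
  lowerAll-inject₁ {zero} [] = refl
  lowerAll-inject₁ {suc m} σ = trans (sym (map-∘ clamp inject₁ σ)) (trans (map-cong clamp-inject₁ σ) (map-id σ))

  inject₁-lowerAll : ∀ {n} (ρ : Vec (Fin (suc n)) n) → (∀ j → lookup ρ j ≢ fromℕ n) → map inject₁ (lowerAll ρ) ≡ ρ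
  inject₁-lowerAll {zero} [] _ = refl
  inject₁-lowerAll {suc m} ρ ρ≢max = trans (sym (map-∘ inject₁ clamp ρ)) (go ρ ρ≢max)
    where
    go : ∀ {k} (xs : Vec (Fin (suc (suc m))) k) → (∀ j → lookup xs j ≢ fromℕ (suc m)) → map (inject₁ ∘ clamp) xs ≡ xs
    go [] _ = refl
    go (x ∷ xs) xs≢max = cong₂ _∷_ (inject₁-clamp x (xs≢max zero)) (go xs (xs≢max ∘ suc))

  insertMax : ∀ {n} → Fin (suc n) → Vec (Fin n) n → Vec (Fin (suc n)) (suc n)
  insertMax {n} s σ = insertAt (map inject₁ σ) s (fromℕ n)

  module _ {n} (s : Fin (suc n)) (σ : Vec (Fin n) n) where

    lookup-insertMax-hole : lookup (insertMax s σ) s ≡ fromℕ n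
    lookup-insertMax-hole = insertAt-lookup (map inject₁ σ) s (fromℕ n)

    lookup-insertMax-punchIn : ∀ j → lookup (insertMax s σ) (punchIn s j) ≡ inject₁ (lookup σ j)
    lookup-insertMax-punchIn j = trans (insertAt-punchIn (map inject₁ σ) s (fromℕ n) j) (lookup-map j inject₁ σ)

    private
      π = insertMax s σ
      π[_] = lookup-insertMax-punchIn

      punched-< : ∀ {j k} → lookup σ j < lookup σ k → lookup π (punchIn s j) < lookup π (punchIn s k)
      punched-< {j} {k} σj<σk = subst₂ _<_ (sym π[ j ]) (sym π[ k ]) (inject₁-mono-< σj<σk)

      punched-<⁻¹ : ∀ {j k} → lookup π (punchIn s j) < lookup π (punchIn s k) → lookup σ j < lookup σ k
      punched-<⁻¹ {j} {k} p = inject₁-cancel-< (subst₂ _<_ π[ j ] π[ k ] p)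

      punched-<-hole : ∀ j → lookup π (punchIn s j) < lookup π s
      punched-<-hole j = subst₂ _<_ (sym π[ j ]) (sym lookup-insertMax-hole) (inject₁<fromℕ _)

      hole-≮ : ∀ p → ¬ lookup π s < lookup π p
      hole-≮ p = fromℕ≮ (lookup π p) ∘ subst (_< lookup π p) lookup-insertMax-hole

    insertMax-isPerm : IsPerm σ → IsPerm π
    insertMax-isPerm σ-perm p q = go (punchInView s p) (punchInView s q)
      where
      go : ∀ {p q} → PunchInView s p → PunchInView s q → lookup π p ≡ lookup π q → p ≡ q
      go hole hole _ = refl
      go hole (punched j) e = ⊥-elim (fromℕ≢inject₁ (trans (sym lookup-insertMax-hole) (trans e π[ j ])))
      go (punched i) hole e = ⊥-elim (fromℕ≢inject₁ (trans (sym lookup-insertMax-hole) (trans (sym e) π[ i ])))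
      go (punched i) (punched j) e =
        cong (punchIn s) (σ-perm i j (inject₁-injective (trans (sym π[ i ]) (trans e π[ j ]))))

    insertMax-isPerm⁻¹ : IsPerm π → IsPerm σ
    insertMax-isPerm⁻¹ π-perm i j e =
      punchIn-injective s i j (π-perm (punchIn s i) (punchIn s j) (trans π[ i ] (trans (cong inject₁ e) (sym π[ j ]))))

    AscentAfter PeakBefore Obstructed : Set
    AscentAfter = Σ (Fin n) λ i → Σ (Fin n) λ j → Σ (Fin n) λ k →
      (toℕ i ℕ.< toℕ s) × (toℕ s ℕ.≤ toℕ j) × (j < k) × (lookup σ j < lookup σ k)
    PeakBefore = Σ (Fin n) λ i → Σ (Fin n) λ j → Σ (Fin n) λ k →
      (i < j) × (j < k) × (toℕ k ℕ.< toℕ s) × (lookup σ i < lookup σ j) × (lookup σ k < lookup σ j)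
    Obstructed = AscentAfter ⊎ PeakBefore

    obstructed? : Dec Obstructed
    obstructed? =
      (any? λ i → any? λ j → any? λ k →
        (toℕ i ℕ.<? toℕ s) ×-dec (toℕ s ℕ.≤? toℕ j) ×-dec (j <? k) ×-dec (lookup σ j <? lookup σ k))
      ⊎-dec
      (any? λ i → any? λ j → any? λ k →
        (i <? j) ×-dec (j <? k) ×-dec (toℕ k ℕ.<? toℕ s) ×-dec (lookup σ i <? lookup σ j) ×-dec (lookup σ k <? lookup σ j))

    insertMax-occurs : Occurs σ → Occurs π
    insertMax-occurs (i₁ , i₂ , i₃ , i₄ , i₁<i₂ , i₂<i₃ , i₃<i₄ , v₁<v₂ , v₃<v₂ , v₃<v₄) =
      punchIn s i₁ , punchIn s i₂ , punchIn s i₃ , punchIn s i₄ ,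
      punchIn-mono-< s _ _ i₁<i₂ , punchIn-mono-< s _ _ i₂<i₃ , punchIn-mono-< s _ _ i₃<i₄ ,
      punched-< v₁<v₂ , punched-< v₃<v₂ , punched-< v₃<v₄

    obstructed⇒insertMax-occurs : Obstructed → Occurs π
    obstructed⇒insertMax-occurs (inj₁ (i , j , k , i<s , s≤j , j<k , vj<vk)) =
      punchIn s i , s , punchIn s j , punchIn s k ,
      subst (ℕ._< toℕ s) (sym (toℕ-punchIn-< s i i<s)) i<s ,
      subst (toℕ s ℕ.<_) (sym (toℕ-punchIn-≥ s j s≤j)) (s≤s s≤j) ,
      punchIn-mono-< s _ _ j<k ,
      punched-<-hole i , punched-<-hole j , punched-< vj<vk
    obstructed⇒insertMax-occurs (inj₂ (i , j , k , i<j , j<k , k<s , vi<vj , vk<vj)) =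
      punchIn s i , punchIn s j , punchIn s k , s ,
      punchIn-mono-< s _ _ i<j , punchIn-mono-< s _ _ j<k ,
      subst (ℕ._< toℕ s) (sym (toℕ-punchIn-< s k k<s)) k<s ,
      punched-< vi<vj , punched-< vk<vj , punched-<-hole k

    insertMax-occurs⁻¹ : Occurs π → Occurs σ ⊎ Obstructed
    insertMax-occurs⁻¹ (i₁ , i₂ , i₃ , i₄ , i₁<i₂ , i₂<i₃ , i₃<i₄ , v₁<v₂ , v₃<v₂ , v₃<v₄) =
      go (punchInView s i₁) (punchInView s i₂) (punchInView s i₃) (punchInView s i₄) i₁<i₂ i₂<i₃ i₃<i₄ v₁<v₂ v₃<v₂ v₃<v₄
      where
      go : ∀ {p₁ p₂ p₃ p₄} → PunchInView s p₁ → PunchInView s p₂ → PunchInView s p₃ → PunchInView s p₄ →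
           p₁ < p₂ → p₂ < p₃ → p₃ < p₄ →
           lookup π p₁ < lookup π p₂ → lookup π p₃ < lookup π p₂ → lookup π p₃ < lookup π p₄ →
           Occurs σ ⊎ Obstructed
      go {p₂ = p₂} hole _ _ _ _ _ _ v₁<v₂ _ _ = ⊥-elim (hole-≮ p₂ v₁<v₂)
      go {p₂ = p₂} _ _ hole _ _ _ _ _ v₃<v₂ _ = ⊥-elim (hole-≮ p₂ v₃<v₂)
      go (punched _) hole (punched _) hole _ p₂<p₃ p₃<p₄ _ _ _ = ⊥-elim (ℕ.<-asym p₂<p₃ p₃<p₄)
      go (punched i) hole (punched j) (punched k) p₁<p₂ p₂<p₃ p₃<p₄ _ _ v₃<v₄ =
        inj₂ (inj₁ (i , j , k , punchIn<s⇒j<s s i p₁<p₂ , s<punchIn⇒s≤j s j p₂<p₃ , punchIn-cancel-< s j k p₃<p₄ ,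
                    punched-<⁻¹ v₃<v₄))
      go (punched i) (punched j) (punched k) hole p₁<p₂ p₂<p₃ p₃<p₄ v₁<v₂ v₃<v₂ _ =
        inj₂ (inj₂ (i , j , k , punchIn-cancel-< s i j p₁<p₂ , punchIn-cancel-< s j k p₂<p₃ , punchIn<s⇒j<s s k p₃<p₄ ,
                    punched-<⁻¹ v₁<v₂ , punched-<⁻¹ v₃<v₂))
      go (punched i₁) (punched i₂) (punched i₃) (punched i₄) p₁<p₂ p₂<p₃ p₃<p₄ v₁<v₂ v₃<v₂ v₃<v₄ =
        inj₁ (i₁ , i₂ , i₃ , i₄ , punchIn-cancel-< s _ _ p₁<p₂ , punchIn-cancel-< s _ _ p₂<p₃ , punchIn-cancel-< s _ _ p₃<p₄ ,
              punched-<⁻¹ v₁<v₂ , punched-<⁻¹ v₃<v₂ , punched-<⁻¹ v₃<v₄)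

    insertMax-avoids : Avoids σ → ¬ Obstructed → Avoids π
    insertMax-avoids σ-avoids unobstructed occ with insertMax-occurs⁻¹ occ
    ... | inj₁ σ-occ = σ-avoids σ-occ
    ... | inj₂ obstructed = unobstructed obstructed

    insertMax-avoids⁻¹ : Avoids π → Avoids σ × ¬ Obstructed
    insertMax-avoids⁻¹ π-avoids = π-avoids ∘ insertMax-occurs , π-avoids ∘ obstructed⇒insertMax-occurs

  module _ {n} (π : Vec (Fin (suc n)) (suc n)) where

    maxPosition : Fin (suc n)
    maxPosition with any? (λ i → lookup π i ≟ fromℕ n)
    ... | yes (i , _) = i
    ... | no _ = zero

    removeMax : Fin (suc n) × Vec (Fin n) n
    removeMax = maxPosition , lowerAll (removeAt π maxPosition)

    lookup-maxPosition : ∀ i → lookup π i ≡ fromℕ n → lookup π maxPosition ≡ fromℕ n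
    lookup-maxPosition i πi≡max with any? (λ i → lookup π i ≟ fromℕ n)
    ... | yes (_ , πj≡max) = πj≡max
    ... | no max∉π = ⊥-elim (max∉π (i , πi≡max))

    isPerm⇒max∈ : IsPerm π → Σ (Fin (suc n)) λ i → lookup π i ≡ fromℕ n
    isPerm⇒max∈ π-perm with any? (λ i → lookup π i ≟ fromℕ n)
    ... | yes max∈π = max∈π
    ... | no max∉π with pigeonhole (ℕ.n<1+n n) (λ i → punchOut (max∉π ∘ (i ,_) ∘ sym))
    ... | i , j , i<j , e =
      ⊥-elim (ℕ.<-irrefl (cong toℕ (π-perm i j (punchOut-injective (max∉π ∘ (i ,_) ∘ sym) (max∉π ∘ (j ,_) ∘ sym) e))) i<j)

    insertMax-removeMax : IsPerm π → uncurry insertMax removeMax ≡ π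
    insertMax-removeMax π-perm =
      trans (cong (λ τ → insertAt τ s (fromℕ n)) (inject₁-lowerAll ρ ρ≢max))
            (trans (cong (insertAt ρ s) (sym πs≡max)) (insertAt-removeAt π s))
      where
      s = maxPosition
      ρ = removeAt π s
      πs≡max = lookup-maxPosition _ (proj₂ (isPerm⇒max∈ π-perm))
      ρ≢max : ∀ j → lookup ρ j ≢ fromℕ n
      ρ≢max j e = punchInᵢ≢i s j (π-perm _ _ (trans (sym (ρ[j] j)) (trans e (sym πs≡max))))
        where
        ρ[j] : ∀ j → lookup ρ j ≡ lookup π (punchIn s j)
        ρ[j] j = trans (cong (lookup ρ) (sym (punchOut-punchIn s))) (removeAt-punchOut π (punchInᵢ≢i s j ∘ sym))

  removeMax-insertMax : ∀ {n} (s : Fin (suc n)) (σ : Vec (Fin n) n) → removeMax (insertMax s σ) ≡ (s , σ)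
  removeMax-insertMax {n} s σ =
    trans (cong (λ t → t , lowerAll (removeAt (insertMax s σ) t)) maxPosition≡s)
          (cong (s ,_) (trans (cong lowerAll (removeAt-insertAt _ s _)) (lowerAll-inject₁ σ)))
    where
    max-only-at-hole : ∀ {p} → PunchInView s p → lookup (insertMax s σ) p ≡ fromℕ n → p ≡ s
    max-only-at-hole hole _ = refl
    max-only-at-hole (punched j) e = ⊥-elim (fromℕ≢inject₁ (trans (sym e) (lookup-insertMax-punchIn s σ j)))
    maxPosition≡s : maxPosition (insertMax s σ) ≡ s
    maxPosition≡s = max-only-at-hole (punchInView s _) (lookup-maxPosition (insertMax s σ) s (lookup-insertMax-hole s σ))

module Ascents where

  open import Defs
  open import Data.Nat as ℕ using (ℕ; zero; suc; z≤n; s≤s; _+_; _∸_)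
  import Data.Nat.Properties as ℕ
  open import Data.Fin using (Fin; zero; suc; toℕ; _<_; opposite; fromℕ<)
  open import Data.Fin.Properties
    using (any?; _<?_; <-cmp; toℕ<n; toℕ-injective; toℕ-fromℕ<; opposite-prop; opposite-involutive)
  open import Data.Vec using (Vec; []; _∷_; lookup; tabulate)
  open import Data.Vec.Properties using (lookup∘tabulate; tabulate∘lookup; tabulate-cong)
  open import Data.Product using (Σ; ∃; _×_; _,_)
  open import Relation.Nullary using (Dec; yes; no; ¬_)
  open import Relation.Nullary.Decidable using (_×-dec_)
  open import Relation.Unary using (Pred; Decidable)
  open import Relation.Binary.Definitions using (tri<; tri≈; tri>)
  open import Relation.Binary.PropositionalEquality
  open import Data.Empty using (⊥-elim)

  AscentAt : ∀ {n} → Vec (Fin n) n → Fin n → Set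
  AscentAt {n} σ j = Σ (Fin n) λ k → j < k × lookup σ j < lookup σ k

  ascentAt? : ∀ {n} (σ : Vec (Fin n) n) → Decidable (AscentAt σ)
  ascentAt? σ j = any? λ k → (j <? k) ×-dec (lookup σ j <? lookup σ k)

  HasAscent : ∀ {n} → Vec (Fin n) n → Set
  HasAscent σ = ∃ (AscentAt σ)

  greatest : ∀ {n p} {P : Pred (Fin n) p} → Decidable P → ∃ P → Σ (Fin n) λ j → P j × (∀ k → j < k → ¬ P k)
  greatest {suc n} P? (i , Pi) with any? (λ k → P? (suc k))
  ... | yes P∘suc with greatest (λ k → P? (suc k)) P∘suc
  ...   | j , Pj , above-j = suc j , Pj , λ { (suc k) (s≤s j<k) → above-j k j<k }
  greatest {suc n} P? (zero , P0) | no ¬P∘suc = zero , P0 , λ { (suc k) _ Pk → ¬P∘suc (k , Pk) }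
  greatest {suc n} P? (suc i , Pi) | no ¬P∘suc = ⊥-elim (¬P∘suc (i , Pi))

  noAscent⇒decreasing : ∀ {n} (σ : Vec (Fin n) n) → IsPerm σ → ∀ i j → i < j → ¬ AscentAt σ i →
                        lookup σ j < lookup σ i
  noAscent⇒decreasing σ σ-perm i j i<j no-ascent with <-cmp (lookup σ i) (lookup σ j)
  ... | tri< σi<σj _ _ = ⊥-elim (no-ascent (j , i<j , σi<σj))
  ... | tri≈ _ σi≡σj _ = ⊥-elim (ℕ.<-irrefl (cong toℕ (σ-perm i j σi≡σj)) i<j)
  ... | tri> _ _ σj<σi = σj<σi

  hasAscent? : ∀ {n} (σ : Vec (Fin n) n) → Dec (HasAscent σ)
  hasAscent? σ = any? (ascentAt? σ)

  decreasing : ∀ {n} → Vec (Fin n) n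
  decreasing = tabulate opposite

  toℕ-lookup-decreasing : ∀ {n} (i : Fin n) → toℕ (lookup decreasing i) ≡ n ∸ suc (toℕ i)
  toℕ-lookup-decreasing i = trans (cong toℕ (lookup∘tabulate opposite i)) (opposite-prop i)

  decreasing-isPerm : ∀ {n} → IsPerm (decreasing {n})
  decreasing-isPerm i j e =
    trans (sym (opposite-involutive i))
          (trans (cong opposite (trans (sym (lookup∘tabulate opposite i)) (trans e (lookup∘tabulate opposite j))))
                 (opposite-involutive j))

  decreasing-noAscent : ∀ {n} → ¬ HasAscent (decreasing {n})
  decreasing-noAscent {n} (i , j , i<j , σi<σj) =
    ℕ.<-irrefl refl (ℕ.<-≤-trans (subst₂ ℕ._<_ (toℕ-lookup-decreasing i) (toℕ-lookup-decreasing j) σi<σj)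
                                 (ℕ.∸-monoʳ-≤ n (s≤s (ℕ.<⇒≤ i<j))))

  decreasing-avoids : ∀ {n} → Avoids (decreasing {n})
  decreasing-avoids (i₁ , i₂ , _ , _ , i₁<i₂ , _ , _ , v₁<v₂ , _) = decreasing-noAscent (i₁ , i₂ , i₁<i₂ , v₁<v₂)

  module _ (n : ℕ) (f : ℕ → ℕ) (f<n : ∀ m → m ℕ.< n → f m ℕ.< n)
           (f-decreasing : ∀ m → suc m ℕ.< n → f (suc m) ℕ.< f m) where

    private
      upper : ∀ m → m ℕ.< n → suc m + f m ℕ.≤ n
      upper zero 0<n = f<n 0 0<n
      upper (suc m) 1+m<n =
        ℕ.≤-trans (s≤s (subst (ℕ._≤ m + f m) (ℕ.+-suc m _) (ℕ.+-monoʳ-≤ m (f-decreasing m 1+m<n))))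
                  (upper m (ℕ.<-trans (ℕ.n<1+n m) 1+m<n))

      lower : ∀ k m → suc (m + k) ≡ n → k ℕ.≤ f m
      lower zero m _ = z≤n
      lower (suc k) m e = ℕ.≤-<-trans (lower k (suc m) e′) (f-decreasing m 1+m<n)
        where
        e′ : suc (suc m + k) ≡ n
        e′ = trans (cong suc (sym (ℕ.+-suc m k))) e
        1+m<n : suc m ℕ.< n
        1+m<n = subst (suc m ℕ.<_) e (s≤s (subst (suc m ℕ.≤_) (sym (ℕ.+-suc m k)) (s≤s (ℕ.m≤m+n m k))))

    strictlyDecreasing⇒≡∸ : ∀ m → m ℕ.< n → f m ≡ n ∸ suc m
    strictlyDecreasing⇒≡∸ m m<n =
      ℕ.≤-antisym (ℕ.m+n≤o⇒m≤o∸n (f m) (subst (ℕ._≤ n) (ℕ.+-comm (suc m) (f m)) (upper m m<n)))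
                  (lower (n ∸ suc m) m (ℕ.m+[n∸m]≡n m<n))

  valueAt : ∀ {n k} → Vec (Fin n) k → ℕ → ℕ
  valueAt [] m = 0
  valueAt (x ∷ xs) zero = toℕ x
  valueAt (x ∷ xs) (suc m) = valueAt xs m

  valueAt-toℕ : ∀ {n k} (xs : Vec (Fin n) k) (i : Fin k) → valueAt xs (toℕ i) ≡ toℕ (lookup xs i)
  valueAt-toℕ (x ∷ xs) zero = refl
  valueAt-toℕ (x ∷ xs) (suc i) = valueAt-toℕ xs i

  noAscent⇒≡decreasing : ∀ {n} (σ : Vec (Fin n) n) → IsPerm σ → ¬ HasAscent σ → σ ≡ decreasing
  noAscent⇒≡decreasing {n} σ σ-perm no-ascent =
    trans (sym (tabulate∘lookup σ)) (tabulate-cong λ i →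
      toℕ-injective (trans (sym (valueAt-toℕ σ i))
                           (trans (strictlyDecreasing⇒≡∸ n (valueAt σ) value<n value-decreasing (toℕ i) (toℕ<n i))
                                  (sym (opposite-prop i)))))
    where
    valueAt-fromℕ< : ∀ m (m<n : m ℕ.< n) → valueAt σ m ≡ toℕ (lookup σ (fromℕ< m<n))
    valueAt-fromℕ< m m<n = trans (cong (valueAt σ) (sym (toℕ-fromℕ< m<n))) (valueAt-toℕ σ _)
    value<n : ∀ m → m ℕ.< n → valueAt σ m ℕ.< n
    value<n m m<n = subst (ℕ._< n) (sym (valueAt-fromℕ< m m<n)) (toℕ<n _)
    value-decreasing : ∀ m → suc m ℕ.< n → valueAt σ (suc m) ℕ.< valueAt σ m
    value-decreasing m 1+m<n =
      subst₂ ℕ._<_ (sym (valueAt-fromℕ< (suc m) 1+m<n)) (sym (valueAt-fromℕ< m m<n))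
        (noAscent⇒decreasing σ σ-perm (fromℕ< m<n) (fromℕ< 1+m<n)
          (subst₂ ℕ._<_ (sym (toℕ-fromℕ< m<n)) (sym (toℕ-fromℕ< 1+m<n)) (ℕ.n<1+n m))
          (λ ascent → no-ascent (_ , ascent)))
      where
      m<n = ℕ.<-trans (ℕ.n<1+n m) 1+m<n

  ≢decreasing⇒hasAscent : ∀ {n} (σ : Vec (Fin n) n) → IsPerm σ → σ ≢ decreasing → HasAscent σ
  ≢decreasing⇒hasAscent σ σ-perm σ≢decreasing with hasAscent? σ
  ... | yes ascent = ascent
  ... | no no-ascent = ⊥-elim (σ≢decreasing (noAscent⇒≡decreasing σ σ-perm no-ascent))

module AdmissibleSlots where

  open import Defs
  open Counting
  open MaximumInsertion using (Obstructed; obstructed?)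
  open Ascents
  open import Data.Nat as ℕ using (ℕ; suc; z≤n; s≤s; _+_)
  import Data.Nat.Properties as ℕ
  open import Data.Fin using (Fin; toℕ; _<_; fromℕ<)
  open import Data.Fin.Properties using (toℕ<n; toℕ≤pred[n]; toℕ-injective; toℕ-fromℕ<; _<?_)
  open import Data.Vec using (Vec; lookup)
  open import Data.List using (allFin)
  open import Data.List.Properties using (length-tabulate)
  open import Data.Product using (_,_)
  open import Data.Sum using (inj₁; inj₂)
  open import Relation.Nullary using (yes; no; ¬_)
  open import Relation.Nullary.Decidable using (¬?)
  open import Relation.Binary.PropositionalEquality
  open import Data.Empty using (⊥; ⊥-elim)
  open import Function using (id; _∘_)

  admissibleSlots : ∀ {n} → Vec (Fin n) n → ℕ
  admissibleSlots {n} σ = ∑[ s ∈ allFin (suc n) ] ⟦ ¬? (obstructed? s σ) ⟧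

  admissibleSlots-noAscent : ∀ {n} (σ : Vec (Fin n) n) → ¬ HasAscent σ → admissibleSlots σ ≡ suc n
  admissibleSlots-noAscent {n} σ no-ascent =
    trans (∑-cong (allFin (suc n)) (λ s → ⟦⟧-yes (¬? (obstructed? s σ)) (unobstructed s)))
          (trans (∑-1≡length (allFin (suc n))) (length-tabulate id))
    where
    unobstructed : ∀ s → ¬ Obstructed s σ
    unobstructed s (inj₁ (_ , j , k , _ , _ , j<k , σj<σk)) = no-ascent (j , k , j<k , σj<σk)
    unobstructed s (inj₂ (i , j , _ , i<j , _ , _ , σi<σj , _)) = no-ascent (i , j , i<j , σi<σj)

  module AfterLastAscent {n} (σ : Vec (Fin n) n) (σ-perm : IsPerm σ) (σ-avoids : Avoids σ)
                         (J K : Fin n) (J<K : J < K) (σJ<σK : lookup σ J < lookup σ K)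
                         (last : ∀ p → J < p → ¬ AscentAt σ p) where

    decreasing-after-J : ∀ p q → J < p → p < q → lookup σ q < lookup σ p
    decreasing-after-J p q J<p p<q = noAscent⇒decreasing σ σ-perm p q p<q (last p J<p)

    private
      1+J<n : suc (toℕ J) ℕ.< n
      1+J<n = ℕ.≤-<-trans J<K (toℕ<n K)

    J⁺ : Fin n
    J⁺ = fromℕ< 1+J<n

    toℕ-J⁺ : toℕ J⁺ ≡ suc (toℕ J)
    toℕ-J⁺ = toℕ-fromℕ< 1+J<n

    J<J⁺ : J < J⁺
    J<J⁺ = subst (toℕ J ℕ.<_) (sym toℕ-J⁺) (ℕ.n<1+n _)

    σJ<σJ⁺ : lookup σ J < lookup σ J⁺
    σJ<σJ⁺ with toℕ K ℕ.≟ suc (toℕ J)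
    ... | yes K≡J⁺ = subst (λ p → lookup σ J < lookup σ p) (toℕ-injective (trans K≡J⁺ (sym toℕ-J⁺))) σJ<σK
    ... | no K≢J⁺ = ℕ.<-trans σJ<σK (decreasing-after-J J⁺ K J<J⁺ (subst (ℕ._< toℕ K) (sym toℕ-J⁺) (ℕ.≤∧≢⇒< J<K (K≢J⁺ ∘ sym))))

    no-peak-up-to-J⁺ : ∀ i j k → i < j → j < k → toℕ k ℕ.≤ suc (toℕ J) →
                       lookup σ i < lookup σ j → lookup σ k < lookup σ j → ⊥
    no-peak-up-to-J⁺ i j k i<j j<k k≤J⁺ σi<σj σk<σj with lookup σ k <? lookup σ J⁺
    ... | yes σk<σJ⁺ = σ-avoids (i , j , k , J⁺ , i<j , j<k , k<J⁺ , σi<σj , σk<σj , σk<σJ⁺)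
      where
      k≢J⁺ : toℕ k ≢ suc (toℕ J)
      k≢J⁺ e = ℕ.<-irrefl (cong (toℕ ∘ lookup σ) (toℕ-injective (trans e (sym toℕ-J⁺)))) σk<σJ⁺
      k<J⁺ : k < J⁺
      k<J⁺ = subst (toℕ k ℕ.<_) (sym toℕ-J⁺) (ℕ.≤∧≢⇒< k≤J⁺ k≢J⁺)
    ... | no σk≮σJ⁺ = σ-avoids (i , j , J , J⁺ , i<j , j<J , J<J⁺ , σi<σj , σJ<σj , σJ<σJ⁺)
      where
      σJ<σj : lookup σ J < lookup σ j
      σJ<σj = ℕ.<-trans (ℕ.<-≤-trans σJ<σJ⁺ (ℕ.≮⇒≥ σk≮σJ⁺)) σk<σj
      j<J : j < J
      j<J = ℕ.≤∧≢⇒< (ℕ.≤-pred (ℕ.<-≤-trans j<k k≤J⁺))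
                    (λ e → ℕ.<-irrefl (cong (toℕ ∘ lookup σ) (toℕ-injective (sym e))) σJ<σj)

    unobstructed-at-0 : ∀ s → toℕ s ≡ 0 → ¬ Obstructed s σ
    unobstructed-at-0 s s≡0 (inj₁ (i , _ , _ , i<s , _)) = ℕ.n≮0 (subst (toℕ i ℕ.<_) s≡0 i<s)
    unobstructed-at-0 s s≡0 (inj₂ (_ , _ , k , _ , _ , k<s , _)) = ℕ.n≮0 (subst (toℕ k ℕ.<_) s≡0 k<s)

    unobstructed-after-J : ∀ s → suc (toℕ J) ℕ.≤ toℕ s → toℕ s ℕ.≤ suc (suc (toℕ J)) → ¬ Obstructed s σ
    unobstructed-after-J s J<s _ (inj₁ (_ , j , k , _ , s≤j , j<k , σj<σk)) =
      ℕ.<-asym σj<σk (decreasing-after-J j k (ℕ.<-≤-trans J<s s≤j) j<k)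
    unobstructed-after-J s _ s≤J⁺⁺ (inj₂ (i , j , k , i<j , j<k , k<s , σi<σj , σk<σj)) =
      no-peak-up-to-J⁺ i j k i<j j<k (ℕ.≤-pred (ℕ.<-≤-trans k<s s≤J⁺⁺)) σi<σj σk<σj

    obstructed-up-to-J : ∀ s → 1 ℕ.≤ toℕ s → toℕ s ℕ.≤ toℕ J → Obstructed s σ
    obstructed-up-to-J s 0<s s≤J =
      inj₁ (fromℕ< 0<n , J , J⁺ , subst (ℕ._< toℕ s) (sym (toℕ-fromℕ< 0<n)) 0<s , s≤J , J<J⁺ , σJ<σJ⁺)
      where
      0<n : 0 ℕ.< n
      0<n = ℕ.≤-<-trans z≤n (toℕ<n J)

    obstructed-beyond-J⁺⁺ : ∀ s → suc (suc (suc (toℕ J))) ℕ.≤ toℕ s → Obstructed s σ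
    obstructed-beyond-J⁺⁺ s 3+J≤s =
      inj₂ (J , J⁺ , J⁺⁺ , J<J⁺ , J⁺<J⁺⁺ , J⁺⁺<s , σJ<σJ⁺ ,
            decreasing-after-J J⁺ J⁺⁺ J<J⁺ J⁺<J⁺⁺)
      where
      2+J<n : suc (suc (toℕ J)) ℕ.< n
      2+J<n = ℕ.<-≤-trans 3+J≤s (toℕ≤pred[n] s)
      J⁺⁺ : Fin n
      J⁺⁺ = fromℕ< 2+J<n
      J⁺<J⁺⁺ : J⁺ < J⁺⁺
      J⁺<J⁺⁺ = subst₂ ℕ._<_ (sym toℕ-J⁺) (sym (toℕ-fromℕ< 2+J<n)) (ℕ.n<1+n _)
      J⁺⁺<s : toℕ J⁺⁺ ℕ.< toℕ s
      J⁺⁺<s = subst (ℕ._< toℕ s) (sym (toℕ-fromℕ< 2+J<n)) 3+J≤s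

    ⟦unobstructed⟧ : ∀ s → ⟦ ¬? (obstructed? s σ) ⟧ ≡
                     ⟦ toℕ s ℕ.≟ 0 ⟧ + ⟦ toℕ s ℕ.≟ suc (toℕ J) ⟧ + ⟦ toℕ s ℕ.≟ suc (suc (toℕ J)) ⟧
    ⟦unobstructed⟧ s with toℕ s ℕ.≟ 0 | toℕ s ℕ.≟ suc (toℕ J) | toℕ s ℕ.≟ suc (suc (toℕ J))
    ... | yes s≡0 | yes s≡1+J | _ = ⊥-elim (ℕ.0≢1+n (trans (sym s≡0) s≡1+J))
    ... | yes s≡0 | no _ | yes s≡2+J = ⊥-elim (ℕ.0≢1+n (trans (sym s≡0) s≡2+J))
    ... | no _ | yes s≡1+J | yes s≡2+J = ⊥-elim (ℕ.1+n≢n (sym (trans (sym s≡1+J) s≡2+J)))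
    ... | yes s≡0 | no _ | no _ = ⟦⟧-yes (¬? (obstructed? s σ)) (unobstructed-at-0 s s≡0)
    ... | no _ | yes s≡1+J | no _ =
      ⟦⟧-yes (¬? (obstructed? s σ)) (unobstructed-after-J s (ℕ.≤-reflexive (sym s≡1+J)) (subst (ℕ._≤ _) (sym s≡1+J) (ℕ.n≤1+n _)))
    ... | no _ | no _ | yes s≡2+J =
      ⟦⟧-yes (¬? (obstructed? s σ)) (unobstructed-after-J s (subst (_ ℕ.≤_) (sym s≡2+J) (ℕ.n≤1+n _)) (ℕ.≤-reflexive s≡2+J))
    ... | no s≢0 | no s≢1+J | no s≢2+J with ℕ.≤-<-connex (toℕ s) (toℕ J)
    ...   | inj₁ s≤J = ⟦⟧-no (¬? (obstructed? s σ)) (λ unobstructed → unobstructed (obstructed-up-to-J s (ℕ.n≢0⇒n>0 s≢0) s≤J))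
    ...   | inj₂ J<s = ⟦⟧-no (¬? (obstructed? s σ)) (λ unobstructed → unobstructed
                         (obstructed-beyond-J⁺⁺ s (ℕ.≤∧≢⇒< (ℕ.≤∧≢⇒< J<s (s≢1+J ∘ sym)) (s≢2+J ∘ sym))))

    admissibleSlots≡3 : admissibleSlots σ ≡ 3
    admissibleSlots≡3 = begin
      admissibleSlots σ
        ≡⟨ ∑-cong (allFin (suc n)) ⟦unobstructed⟧ ⟩
      ∑[ s ∈ allFin (suc n) ] (at 0 s + at (suc (toℕ J)) s + at (suc (suc (toℕ J))) s)
        ≡⟨ ∑-+ (allFin (suc n)) (λ s → at 0 s + at (suc (toℕ J)) s) (at (suc (suc (toℕ J)))) ⟩
      ∑[ s ∈ allFin (suc n) ] (at 0 s + at (suc (toℕ J)) s) + count (suc (suc (toℕ J)))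
        ≡⟨ cong (_+ count (suc (suc (toℕ J)))) (∑-+ (allFin (suc n)) (at 0) (at (suc (toℕ J)))) ⟩
      count 0 + count (suc (toℕ J)) + count (suc (suc (toℕ J)))
        ≡⟨ cong₂ _+_ (cong₂ _+_ (∑-allFin-toℕ≡ (suc n) 0 (s≤s z≤n)) (∑-allFin-toℕ≡ (suc n) _ (s≤s (toℕ<n J))))
                     (∑-allFin-toℕ≡ (suc n) _ (s≤s 1+J<n)) ⟩
      3 ∎
      where
      open ≡-Reasoning
      at : ℕ → Fin (suc n) → ℕ
      at c s = ⟦ toℕ s ℕ.≟ c ⟧
      count : ℕ → ℕ
      count c = ∑ (allFin (suc n)) (at c)

  admissibleSlots-ascent : ∀ {n} (σ : Vec (Fin n) n) → IsPerm σ → Avoids σ → HasAscent σ → admissibleSlots σ ≡ 3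
  admissibleSlots-ascent σ σ-perm σ-avoids ascent with greatest (ascentAt? σ) ascent
  ... | J , (K , J<K , σJ<σK) , last = AfterLastAscent.admissibleSlots≡3 σ σ-perm σ-avoids J K J<K σJ<σK last

module Recurrence where

  open import Defs
  open Counting
  open MaximumInsertion
  open Ascents
  open AdmissibleSlots
  open import Data.Nat using (ℕ; zero; suc; _+_; _*_)
  open import Data.Nat.Properties using (+-comm; *-comm; *-identityʳ)
  open import Data.Fin using (Fin)
  import Data.Fin.Properties as Fin
  open import Data.Vec using (Vec; []; _∷_)
  import Data.Vec.Properties as Vec
  open import Data.List using (List; map; concatMap; allFin)
  open import Data.Product using (_×_; _,_; proj₁; proj₂; uncurry)
  import Data.Product.Properties as Product
  open import Relation.Nullary using (Dec; yes; no; ¬_)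
  open import Relation.Nullary.Decidable using (_×-dec_; ¬?)
  open import Relation.Binary.Definitions using (DecidableEquality)
  open import Relation.Binary.PropositionalEquality

  _≟ᵛ_ : ∀ {n k} → DecidableEquality (Vec (Fin n) k)
  _≟ᵛ_ = Vec.≡-dec Fin._≟_

  words-isEnumeration : ∀ n k → IsEnumeration (_≟ᵛ_ {n} {k}) (words n k)
  words-isEnumeration n zero [] = refl
  words-isEnumeration n (suc k) =
    pairs-isEnumeration Fin._≟_ _≟ᵛ_ _≟ᵛ_ _∷_ (λ { (x ∷ xs) → x , xs , refl }) Vec.∷-injective
                        (allFin n) (words n k) (allFin-isEnumeration n) (words-isEnumeration n k)

  avoider? : ∀ {n} (π : Vec (Fin n) n) → Dec (IsPerm π × Avoids π)
  avoider? π = isPerm? π ×-dec ¬? (occurs? π)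

  a≡∑ : ∀ n → a n ≡ ∑[ σ ∈ words n n ] ⟦ avoider? σ ⟧
  a≡∑ n = length-filter≡∑ avoider? (words n n)

  module _ (n : ℕ) where

    private
      Slot = Fin (suc n) × Vec (Fin n) n

      _≟ˢ_ : DecidableEquality Slot
      _≟ˢ_ = Product.≡-dec Fin._≟_ _≟ᵛ_

      slots : List Slot
      slots = concatMap (λ s → map (s ,_) (words n n)) (allFin (suc n))

      slots-isEnumeration : IsEnumeration _≟ˢ_ slots
      slots-isEnumeration = pairs-isEnumeration Fin._≟_ _≟ᵛ_ _≟ˢ_ _,_ (λ { (s , σ) → s , σ , refl }) Product.,-injective
                                                (allFin (suc n)) (words n n) (allFin-isEnumeration (suc n)) (words-isEnumeration n n)

      Insertable : Slot → Set
      Insertable (s , σ) = (IsPerm σ × Avoids σ) × ¬ Obstructed s σ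

      insertable? : (b : Slot) → Dec (Insertable b)
      insertable? (s , σ) = avoider? σ ×-dec ¬? (obstructed? s σ)

      removeMax-insertable : ∀ π → IsPerm π × Avoids π → Insertable (removeMax π) × uncurry insertMax (removeMax π) ≡ π
      removeMax-insertable π (π-perm , π-avoids) =
        ((insertMax-isPerm⁻¹ s σ (subst IsPerm (sym inverse) π-perm) , proj₁ avoids) , proj₂ avoids) , inverse
        where
        s = proj₁ (removeMax π)
        σ = proj₂ (removeMax π)
        inverse = insertMax-removeMax π π-perm
        avoids = insertMax-avoids⁻¹ s σ (subst Avoids (sym inverse) π-avoids)

      insertMax-avoider : ∀ b → Insertable b → (IsPerm (uncurry insertMax b) × Avoids (uncurry insertMax b)) × removeMax (uncurry insertMax b) ≡ b
      insertMax-avoider (s , σ) ((σ-perm , σ-avoids) , unobstructed) =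
        (insertMax-isPerm s σ σ-perm , insertMax-avoids s σ σ-avoids unobstructed) , removeMax-insertMax s σ

    a-suc≡∑ : a (suc n) ≡ ∑[ σ ∈ words n n ] (⟦ avoider? σ ⟧ * admissibleSlots σ)
    a-suc≡∑ = begin
      a (suc n)
        ≡⟨ a≡∑ (suc n) ⟩
      ∑[ π ∈ words (suc n) (suc n) ] ⟦ avoider? π ⟧
        ≡⟨ ∑⟦⟧-bijection _≟ᵛ_ _≟ˢ_ avoider? insertable? removeMax (uncurry insertMax) removeMax-insertable insertMax-avoider
                         (words (suc n) (suc n)) slots (words-isEnumeration (suc n) (suc n)) slots-isEnumeration ⟩
      ∑[ b ∈ slots ] ⟦ insertable? b ⟧
        ≡⟨ ∑-concatMap (λ s → map (s ,_) (words n n)) (allFin (suc n)) (λ b → ⟦ insertable? b ⟧) ⟩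
      ∑[ s ∈ allFin (suc n) ] ∑ (map (s ,_) (words n n)) (λ b → ⟦ insertable? b ⟧)
        ≡⟨ ∑-cong (allFin (suc n)) (λ s → trans (∑-map (s ,_) (words n n) _)
                                               (∑-cong (words n n) (λ σ → ⟦⟧-× (avoider? σ) (¬? (obstructed? s σ))))) ⟩
      ∑[ s ∈ allFin (suc n) ] ∑[ σ ∈ words n n ] (⟦ avoider? σ ⟧ * ⟦ ¬? (obstructed? s σ) ⟧)
        ≡⟨ ∑-comm (allFin (suc n)) (words n n) _ ⟩
      ∑[ σ ∈ words n n ] ∑[ s ∈ allFin (suc n) ] (⟦ avoider? σ ⟧ * ⟦ ¬? (obstructed? s σ) ⟧)
        ≡⟨ ∑-cong (words n n) (λ σ → ∑-*ˡ (allFin (suc n)) ⟦ avoider? σ ⟧ _) ⟩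
      ∑[ σ ∈ words n n ] (⟦ avoider? σ ⟧ * admissibleSlots σ) ∎
      where open ≡-Reasoning

    -- Every avoider has 3 admissible slots, except the decreasing one, which has n + 1.
    admissibleSlots-identity : ∀ (σ : Vec (Fin n) n) → ⟦ avoider? σ ⟧ * admissibleSlots σ + 3 * ⟦ σ ≟ᵛ decreasing ⟧ ≡
                                     3 * ⟦ avoider? σ ⟧ + ⟦ σ ≟ᵛ decreasing ⟧ * suc n
    admissibleSlots-identity σ with σ ≟ᵛ decreasing
    ... | yes refl = begin
      ⟦ avoider? (decreasing {n}) ⟧ * admissibleSlots (decreasing {n}) + 3
        ≡⟨ cong₂ (λ x y → x * y + 3) (⟦⟧-yes (avoider? (decreasing {n})) (decreasing-isPerm , decreasing-avoids))
                                     (admissibleSlots-noAscent decreasing decreasing-noAscent) ⟩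
      1 * suc n + 3
        ≡⟨ +-comm (1 * suc n) 3 ⟩
      3 + 1 * suc n
        ≡⟨ cong (λ x → 3 * x + 1 * suc n) (sym (⟦⟧-yes (avoider? (decreasing {n})) (decreasing-isPerm , decreasing-avoids))) ⟩
      3 * ⟦ avoider? (decreasing {n}) ⟧ + 1 * suc n ∎
      where open ≡-Reasoning
    ... | no σ≢decreasing with avoider? σ
    ...   | no _ = refl
    ...   | yes (σ-perm , σ-avoids) =
      cong (λ x → 1 * x + 0) (admissibleSlots-ascent σ σ-perm σ-avoids (≢decreasing⇒hasAscent σ σ-perm σ≢decreasing))

    a-suc : a (suc n) + 3 ≡ 3 * a n + suc n
    a-suc = begin
      a (suc n) + 3
        ≡⟨ cong₂ _+_ a-suc≡∑ (cong (3 *_) (sym (words-isEnumeration n n decreasing))) ⟩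
      ∑[ σ ∈ W ] (⟦ avoider? σ ⟧ * admissibleSlots σ) + 3 * ∑[ σ ∈ W ] ⟦ σ ≟ᵛ decreasing ⟧
        ≡⟨ cong (∑[ σ ∈ W ] (⟦ avoider? σ ⟧ * admissibleSlots σ) +_) (sym (∑-*ˡ W 3 (λ σ → ⟦ σ ≟ᵛ decreasing ⟧))) ⟩
      ∑[ σ ∈ W ] (⟦ avoider? σ ⟧ * admissibleSlots σ) + ∑[ σ ∈ W ] (3 * ⟦ σ ≟ᵛ decreasing ⟧)
        ≡⟨ sym (∑-+ W _ _) ⟩
      ∑[ σ ∈ W ] (⟦ avoider? σ ⟧ * admissibleSlots σ + 3 * ⟦ σ ≟ᵛ decreasing ⟧)
        ≡⟨ ∑-cong W admissibleSlots-identity ⟩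
      ∑[ σ ∈ W ] (3 * ⟦ avoider? σ ⟧ + ⟦ σ ≟ᵛ decreasing ⟧ * suc n)
        ≡⟨ ∑-+ W _ _ ⟩
      ∑[ σ ∈ W ] (3 * ⟦ avoider? σ ⟧) + ∑[ σ ∈ W ] (⟦ σ ≟ᵛ decreasing ⟧ * suc n)
        ≡⟨ cong₂ _+_ (∑-*ˡ W 3 _) (trans (∑-cong W (λ σ → *-comm ⟦ σ ≟ᵛ decreasing ⟧ (suc n))) (∑-*ˡ W (suc n) _)) ⟩
      3 * ∑[ σ ∈ W ] ⟦ avoider? σ ⟧ + suc n * ∑[ σ ∈ W ] ⟦ σ ≟ᵛ decreasing ⟧
        ≡⟨ cong₂ (λ x y → 3 * x + suc n * y) (sym (a≡∑ n)) (words-isEnumeration n n decreasing) ⟩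
      3 * a n + suc n * 1
        ≡⟨ cong (3 * a n +_) (*-identityʳ (suc n)) ⟩
      3 * a n + suc n ∎
      where
      open ≡-Reasoning
      W = words n n

module ClosedForms where

  open import Defs
  open Recurrence using (a-suc)
  open import Data.Nat as ℕ using (ℕ; zero; suc; _^_)
  open import Data.Integer using (ℤ; +_; -_; _+_; _-_; _*_)
  open import Data.Integer.Properties using (pos-+; pos-*; +-identityʳ)
  open import Data.Integer.Tactic.RingSolver using (solve; solve-∀)
  open import Data.List using ([]; _∷_; map; foldr; applyUpTo)
  open import Relation.Binary.PropositionalEquality
  open import Function using (_∘_)
  open ≡-Reasoning

  private
    cancel-+3 : ∀ x x₀ N → x + + 3 ≡ + 3 * x₀ + (+ 1 + N) → x ≡ + 3 * x₀ + N - + 2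
    cancel-+3 x x₀ N e = begin
      x                               ≡⟨ solve (x ∷ []) ⟩
      x + + 3 - + 3                   ≡⟨ cong (_- + 3) e ⟩
      + 3 * x₀ + (+ 1 + N) - + 3      ≡⟨ solve (x₀ ∷ N ∷ []) ⟩
      + 3 * x₀ + N - + 2 ∎

  a-suc-ℤ : ∀ n → + a (suc n) ≡ + 3 * + a n + + n - + 2
  a-suc-ℤ n = cancel-+3 (+ a (suc n)) (+ a n) (+ n)
    (trans (sym (pos-+ (a (suc n)) 3))
           (trans (cong +_ (a-suc n)) (trans (pos-+ (3 ℕ.* a n) (suc n)) (cong₂ _+_ (pos-* 3 (a n)) (pos-+ 1 n)))))

  private
    second-order-step : ∀ x₁ x₀ N → x₁ ≡ + 3 * x₀ + N - + 2 → + 3 * x₁ + (+ 1 + N) - + 2 ≡ + 4 * x₁ - + 3 * x₀ + + 1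
    second-order-step ._ x₀ N refl = solve (x₀ ∷ N ∷ [])

    closed-form-step : ∀ x N T → + 4 * x ≡ T - + 2 * N + + 3 →
                       + 4 * (+ 3 * x + N - + 2) ≡ + 3 * T - + 2 * (+ 1 + N) + + 3
    closed-form-step x N T e = begin
      + 4 * (+ 3 * x + N - + 2)             ≡⟨ solve (x ∷ N ∷ []) ⟩
      + 3 * (+ 4 * x) + + 4 * N - + 8       ≡⟨ cong (λ y → + 3 * y + + 4 * N - + 8) e ⟩
      + 3 * (T - + 2 * N + + 3) + + 4 * N - + 8 ≡⟨ solve (T ∷ N ∷ []) ⟩
      + 3 * T - + 2 * (+ 1 + N) + + 3 ∎

  a-suc-suc : ∀ n → + a (suc (suc n)) ≡ + 4 * + a (suc n) - + 3 * + a n + + 1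
  a-suc-suc n = begin
    + a (suc (suc n))                        ≡⟨ a-suc-ℤ (suc n) ⟩
    + 3 * + a (suc n) + + suc n - + 2        ≡⟨ cong (λ N → + 3 * + a (suc n) + N - + 2) (pos-+ 1 n) ⟩
    + 3 * + a (suc n) + (+ 1 + + n) - + 2    ≡⟨ second-order-step (+ a (suc n)) (+ a n) (+ n) (a-suc-ℤ n) ⟩
    + 4 * + a (suc n) - + 3 * + a n + + 1 ∎

  closed-form : ∀ n → + 4 * + a n ≡ + (3 ^ n) - + 2 * + n + + 3
  closed-form zero = refl
  closed-form (suc n) = begin
    + 4 * + a (suc n)                           ≡⟨ cong (+ 4 *_) (a-suc-ℤ n) ⟩
    + 4 * (+ 3 * + a n + + n - + 2)             ≡⟨ closed-form-step (+ a n) (+ n) (+ (3 ^ n)) (closed-form n) ⟩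
    + 3 * + (3 ^ n) - + 2 * (+ 1 + + n) + + 3   ≡⟨ sym (cong₂ (λ T N → T - + 2 * N + + 3) (pos-* 3 (3 ^ n)) (pos-+ 1 n)) ⟩
    + (3 ^ suc n) - + 2 * + suc n + + 3 ∎

  foldr-map-applyUpTo-zero : ∀ (h : ℕ → ℤ) (f : ℕ → ℕ) n → (∀ m → h (f m) ≡ + 0) →
                             foldr _+_ (+ 0) (map h (applyUpTo f n)) ≡ + 0
  foldr-map-applyUpTo-zero h f zero h∘f≡0 = refl
  foldr-map-applyUpTo-zero h f (suc n) h∘f≡0 = cong₂ _+_ (h∘f≡0 0) (foldr-map-applyUpTo-zero h (f ∘ suc) n (h∘f≡0 ∘ suc))

  ⊛-linear : ∀ c₀ c₁ F n → (poly (c₀ ∷ c₁ ∷ []) ⊛ F) (suc n) ≡ c₀ * F (suc n) + c₁ * F n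
  ⊛-linear c₀ c₁ F n =
    cong (λ r → c₀ * F (suc n) + r)
         (trans (cong (λ r → c₁ * F n + r) (foldr-map-applyUpTo-zero _ (suc ∘ suc) n (λ m → refl)))
                (+-identityʳ (c₁ * F n)))

  Δ : Series → Series
  Δ F = poly (+ 1 ∷ - + 1 ∷ []) ⊛ F

  ΔΔ-suc-suc : ∀ F k → Δ (Δ F) (suc (suc k)) ≡ F (suc (suc k)) - + 2 * F (suc k) + F k
  ΔΔ-suc-suc F k = begin
    Δ (Δ F) (suc (suc k))
      ≡⟨ ⊛-linear (+ 1) (- + 1) (Δ F) (suc k) ⟩
    + 1 * Δ F (suc (suc k)) + - + 1 * Δ F (suc k)
      ≡⟨ cong₂ (λ u v → + 1 * u + - + 1 * v) (⊛-linear (+ 1) (- + 1) F (suc k)) (⊛-linear (+ 1) (- + 1) F k) ⟩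
    + 1 * (+ 1 * F (suc (suc k)) + - + 1 * F (suc k)) + - + 1 * (+ 1 * F (suc k) + - + 1 * F k)
      ≡⟨ normalise (F (suc (suc k))) (F (suc k)) (F k) ⟩
    F (suc (suc k)) - + 2 * F (suc k) + F k ∎
    where
    normalise : ∀ x y z → + 1 * (+ 1 * x + - + 1 * y) + - + 1 * (+ 1 * y + - + 1 * z) ≡ x - + 2 * y + z
    normalise = solve-∀

  private
    recurrence-annihilates : ∀ x₃ x₂ x₁ x₀ → x₃ ≡ + 4 * x₂ - + 3 * x₁ + + 1 → x₂ ≡ + 4 * x₁ - + 3 * x₀ + + 1 →
                             + 1 * (x₃ - + 2 * x₂ + x₁) + - + 3 * (x₂ - + 2 * x₁ + x₀) ≡ + 0
    recurrence-annihilates ._ ._ x₁ x₀ refl refl = solve (x₁ ∷ x₀ ∷ [])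

  generating-function : ∀ n → (poly (+ 1 ∷ - + 3 ∷ []) ⊛ Δ (Δ A)) n ≡ (poly (+ 1 ∷ - + 2 ∷ []) ⊛ poly (+ 1 ∷ - + 2 ∷ [])) n
  generating-function zero = refl
  generating-function (suc zero) = refl
  generating-function (suc (suc zero)) = refl
  generating-function (suc (suc (suc m))) = begin
    (poly (+ 1 ∷ - + 3 ∷ []) ⊛ Δ (Δ A)) (suc (suc (suc m)))
      ≡⟨ ⊛-linear (+ 1) (- + 3) (Δ (Δ A)) (suc (suc m)) ⟩
    + 1 * Δ (Δ A) (suc (suc (suc m))) + - + 3 * Δ (Δ A) (suc (suc m))
      ≡⟨ cong₂ (λ u v → + 1 * u + - + 3 * v) (ΔΔ-suc-suc A (suc m)) (ΔΔ-suc-suc A m) ⟩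
    + 1 * (A (suc (suc (suc m))) - + 2 * A (suc (suc m)) + A (suc m)) + - + 3 * (A (suc (suc m)) - + 2 * A (suc m) + A m)
      ≡⟨ recurrence-annihilates _ _ (A (suc m)) (A m) (a-suc-suc (suc m)) (a-suc-suc m) ⟩
    + 0
      ≡⟨ sym (⊛-linear (+ 1) (- + 2) (poly (+ 1 ∷ - + 2 ∷ [])) (suc (suc m))) ⟩
    (poly (+ 1 ∷ - + 2 ∷ []) ⊛ poly (+ 1 ∷ - + 2 ∷ [])) (suc (suc (suc m))) ∎

open import Defs
open import Data.Nat using (ℕ; suc; _^_)
open import Data.Integer using (ℤ; +_; -_; _+_; _-_; _*_)
open import Data.List using (List; []; _∷_)
open import Data.Product using (_×_; _,_)
open import Relation.Binary.PropositionalEquality using (_≡_; refl)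
open ClosedForms using (a-suc-suc; closed-form; generating-function)

theorem11 : (a 0 ≡ 1) × (a 1 ≡ 1)
    × (∀ n → + a (suc (suc n)) ≡ + 4 * + a (suc n) - + 3 * + a n + + 1)
    × (∀ n → + 4 * + a n ≡ + (3 ^ n) - + 2 * + n + + 3)
    × (∀ n → (poly (+ 1 ∷ - + 3 ∷ []) ⊛ (poly (+ 1 ∷ - + 1 ∷ []) ⊛ (poly (+ 1 ∷ - + 1 ∷ []) ⊛ A))) n
             ≡ (poly (+ 1 ∷ - + 2 ∷ []) ⊛ poly (+ 1 ∷ - + 2 ∷ [])) n)
theorem11 = refl , refl , a-suc-suc , closed-form , generating-function
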